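{- Let $h\in\mathbb{Z}$ and let $k$ be a positive integer. The generating function $\sum_{n\ge0} b_{h,k}(n)q^n$, where $b_{h,k}(n)$ is the number of partitions $\lambda=(\lambda_1,\dots,\lambda_t)\vdash n$ having an $h$-fixed hook of size $k$ (i.e. there is $s$ with $1\le s\le t$ and $h_{s,1}(\lambda)=s+h=k$), equals $$\sum_{l=1}^k \frac{q^{k+l(k-h-1)}}{(q)_{k-h-1}}\begin{bmatrix} k-1\\ l-1\end{bmatrix}_q.$$
   Context: A partition $\lambda=(\lambda_1,\dots,\lambda_t)$ of $n$ is a nonincreasing sequence of positive integers with sum $n$. First-column hook lengths: $h_{s,1}(\lambda)=\lambda_s+t-s$ for $1\le s\le t$. An $h$-fixed hook is an index $s$ with $h_{s,1}(\lambda)=s+h$; its size is the hook length $h_{s,1}(\lambda)$. Notation: $(a;q)_\infty=\prod_{j\ge0}(1-aq^j)$, $(q)_m=(q;q)_\infty/(q^{m+1};q)_\infty$ (so $1/(q)_m=0$ for negative integers $m$), and $\begin{bmatrix} A\\ B\end{bmatrix}_q=\frac{(q)_A}{(q)_B(q)_{A-B}}$. -}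

module Defs where

open import Data.Nat as ℕ using (ℕ; zero; suc; _<_; _≥_)
open import Data.Nat.Divisibility using (_∣?_)
open import Data.Integer as ℤ using (ℤ; +_; -[1+_])
open import Data.Fin using (Fin; toℕ)
open import Data.List using (List; length; lookup)
open import Data.Nat.ListAction using (sum)
open import Data.List.Relation.Unary.All using (All)
open import Data.List.Relation.Unary.Linked using (Linked)
open import Data.Product using (_×_; ∃-syntax)
open import Relation.Nullary.Decidable using (does)
open import Data.Bool using (if_then_else_)
open import Relation.Binary.PropositionalEquality using (_≡_)

IsPartition : ℕ → List ℕ → Set
IsPartition n μ = All (0 <_) μ × Linked _≥_ μ × sum μ ≡ n

-- First-column hook length h_{s,1}(λ) = λ_s + t - s, where s = toℕ i + 1.
hook1 : (μ : List ℕ) → Fin (length μ) → ℤ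
hook1 μ i = + lookup μ i ℤ.+ (+ length μ ℤ.- + suc (toℕ i))

HasFixedHookOfSize : ℤ → ℕ → List ℕ → Set
HasFixedHookOfSize h k μ =
  ∃[ i ] (hook1 μ i ≡ + suc (toℕ i) ℤ.+ h × + suc (toℕ i) ℤ.+ h ≡ + k)

FPS : Set
FPS = ℕ → ℤ

Σ≤ : ℕ → (ℕ → ℤ) → ℤ
Σ≤ zero    f = f 0
Σ≤ (suc n) f = Σ≤ n f ℤ.+ f (suc n)

Σ1 : ℕ → (ℕ → ℤ) → ℤ
Σ1 zero    f = + 0
Σ1 (suc n) f = Σ1 n f ℤ.+ f (suc n)

zeroS : FPS
zeroS _ = + 0

oneS : FPS
oneS zero    = + 1
oneS (suc _) = + 0

_⊕_ : FPS → FPS → FPS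
(f ⊕ g) n = f n ℤ.+ g n

_⊗_ : FPS → FPS → FPS
(f ⊗ g) n = Σ≤ n (λ i → f i ℤ.* g (n ℕ.∸ i))

qPow : ℕ → FPS
qPow e n = if does (n ℕ.≟ e) then + 1 else + 0

oneMinusQPow : ℕ → FPS
oneMinusQPow j n = oneS n ℤ.- qPow j n

-- 1/(1 - q^j) = Σ_{r≥0} q^{j r}  (for j ≥ 1)
geomInv : ℕ → FPS
geomInv j n = if does (j ∣? n) then + 1 else + 0

qPoch : ℕ → FPS
qPoch zero    = oneS
qPoch (suc m) = qPoch m ⊗ oneMinusQPow (suc m)

qPochInv : ℤ → FPS
qPochInv (+ zero)    = oneS
qPochInv (+ suc m)   = qPochInv (+ m) ⊗ geomInv (suc m)
qPochInv -[1+ _ ]    = zeroS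

gaussBinom : ℕ → ℕ → FPS
gaussBinom A B = (qPoch A ⊗ qPochInv (+ B)) ⊗ qPochInv (+ A ℤ.- + B)

ΣS : ℕ → (ℕ → FPS) → FPS
ΣS zero    F = zeroS
ΣS (suc k) F = ΣS k F ⊕ F (suc k)

-- The l-th summand  q^{k + l(k-h-1)} / (q)_{k-h-1} · [k-1; l-1]_q.
-- When m = k-h-1 < 0 the factor 1/(q)_m is 0, so the summand is 0.
rhsTerm : ℤ → ℕ → ℕ → FPS
rhsTerm h k l with + k ℤ.- h ℤ.- + 1
... | + m      = (qPow (k ℕ.+ l ℕ.* m) ⊗ qPochInv (+ m)) ⊗ gaussBinom (k ℕ.∸ 1) (l ℕ.∸ 1)
... | -[1+ _ ] = zeroS

rhsSeries : ℤ → ℕ → FPS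
rhsSeries h k = ΣS k (rhsTerm h k)

module Submission where

-- Let m = k - h - 1.  The hook h_{s,1} = λ_s + t - s is h-fixed of size k exactly when s = m + 1 and
-- λ_{m+1} + (t - m - 1) = k.  Writing l = λ_{m+1}, such partitions are exactly (l + y) ++ l ∷ (1 + z) with
-- 1 ≤ l ≤ k, y nonincreasing of length m, and z nonincreasing of length k - l with parts ≤ l - 1; the
-- decomposition is unique and the size is k + l m + |y| + |z|.  Nonincreasing sequences of length m are
-- counted by 1/(q)_m (subtract the last part from every part), those in a (k - l) × (l - 1) box by
-- [k-1; l-1]_q (q-Pascal recurrence), and summing over l gives the formula.  For m < 0 both sides vanish.

open import Defs
open import Algebra.Bundles using (CommutativeMonoid)
open import Data.Bool using (if_then_else_)
open import Data.Empty using (⊥; ⊥-elim)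
open import Data.Fin using (Fin; toℕ; fromℕ<) renaming (zero to fzero; suc to fsuc)
open import Data.Fin.Properties using (toℕ-fromℕ<)
open import Data.Integer as ℤ using (ℤ; +_; -[1+_])
import Data.Integer.Properties as ℤ
open import Data.Integer.Tactic.RingSolver using (solve-∀)
open import Data.List using (List; []; _∷_; _++_; _∷ʳ_; map; length; lookup; cartesianProduct; initLast; _∷ʳ′_)
open import Data.List.Membership.Propositional using (_∈_)
open import Data.List.Membership.Propositional.Properties
  using (∈-++⁻; ∈-++⁺ˡ; ∈-++⁺ʳ; ∈-map⁻; ∈-map⁺; ∈-cartesianProduct⁻; ∈-cartesianProduct⁺)
open import Data.List.Properties using (length-++; length-map; map-injective; ∷ʳ-injective; ∷-injective; ∷-injectiveʳ)
open import Data.List.Relation.Unary.All using (All; []; _∷_)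
import Data.List.Relation.Unary.All as All
import Data.List.Relation.Unary.All.Properties as All
open import Data.List.Relation.Unary.AllPairs using ([]; _∷_)
open import Data.List.Relation.Unary.Any using (here; there)
open import Data.List.Relation.Unary.Linked using (Linked; []; [-]; _∷_)
import Data.List.Relation.Unary.Linked as Linked
import Data.List.Relation.Unary.Linked.Properties as Linked
open import Data.List.Relation.Unary.Unique.Propositional using (Unique)
import Data.List.Relation.Unary.Unique.Propositional.Properties as Unique
open import Data.Nat using (ℕ; _≟_; zero; suc; _+_; _*_; _∸_; _≤_; _<_; _≥_; z≤n; s≤s; NonZero)
open import Data.Nat.Divisibility using (_∣?_; divides; ∣m+n∣m⇒∣n; ∣m∣n⇒∣m+n; ∣-refl; ∣⇒≤)
open import Data.Nat.ListAction using (sum)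
open import Data.Nat.ListAction.Properties using (sum-++)
open import Data.Nat.Properties
open import Data.Nat.Solver using (module +-*-Solver)
open +-*-Solver using (_:+_; _:*_; _:=_; con) renaming (solve to solveℕ)
open import Data.Product using (Σ; _×_; _,_; proj₁; proj₂; ∃-syntax; map₁; map₂)
open import Data.Sum using (_⊎_; inj₁; inj₂)
open import Data.Unit using (⊤; tt)
open import Function using (_∘_)
open import Function.Bundles using (_⇔_; mk⇔)
open import Level using (0ℓ)
open import Relation.Binary.PropositionalEquality
open import Relation.Nullary using (¬_)
open import Relation.Nullary.Decidable using (Dec; yes; no; does; map′; dec-false; does-⇔)

Σ≤-cong : ∀ n {f g} → (∀ i → i ≤ n → f i ≡ g i) → Σ≤ n f ≡ Σ≤ n g
Σ≤-cong zero    f≡g = f≡g 0 z≤n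
Σ≤-cong (suc n) f≡g = cong₂ ℤ._+_ (Σ≤-cong n (λ i i≤n → f≡g i (m≤n⇒m≤1+n i≤n))) (f≡g (suc n) ≤-refl)

Σ≤-zero : ∀ n {f} → (∀ i → i ≤ n → f i ≡ + 0) → Σ≤ n f ≡ + 0
Σ≤-zero n f≡0 = trans (Σ≤-cong n f≡0) (Σ≤-const0 n)
  where
  Σ≤-const0 : ∀ n → Σ≤ n (λ _ → + 0) ≡ + 0
  Σ≤-const0 zero    = refl
  Σ≤-const0 (suc n) = cong (ℤ._+ + 0) (Σ≤-const0 n)

Σ≤-+ : ∀ n f g → Σ≤ n (λ i → f i ℤ.+ g i) ≡ Σ≤ n f ℤ.+ Σ≤ n g
Σ≤-+ zero    f g = refl
Σ≤-+ (suc n) f g = trans (cong (ℤ._+ (f (suc n) ℤ.+ g (suc n))) (Σ≤-+ n f g))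
                         (interchange (Σ≤ n f) (Σ≤ n g) (f (suc n)) (g (suc n)))
  where
  interchange : ∀ a b c d → (a ℤ.+ b) ℤ.+ (c ℤ.+ d) ≡ (a ℤ.+ c) ℤ.+ (b ℤ.+ d)
  interchange = solve-∀

Σ≤-neg : ∀ n f → Σ≤ n (λ i → ℤ.- f i) ≡ ℤ.- Σ≤ n f
Σ≤-neg zero    f = refl
Σ≤-neg (suc n) f = trans (cong (ℤ._- f (suc n)) (Σ≤-neg n f)) (sym (ℤ.neg-distrib-+ (Σ≤ n f) (f (suc n))))

Σ≤-- : ∀ n f g → Σ≤ n (λ i → f i ℤ.- g i) ≡ Σ≤ n f ℤ.- Σ≤ n g
Σ≤-- n f g = trans (Σ≤-+ n f (λ i → ℤ.- g i)) (cong (λ x → Σ≤ n f ℤ.+ x) (Σ≤-neg n g))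

Σ≤-*ˡ : ∀ n c f → Σ≤ n (λ i → c ℤ.* f i) ≡ c ℤ.* Σ≤ n f
Σ≤-*ˡ zero    c f = refl
Σ≤-*ˡ (suc n) c f = trans (cong (ℤ._+ c ℤ.* f (suc n)) (Σ≤-*ˡ n c f)) (sym (ℤ.*-distribˡ-+ c (Σ≤ n f) (f (suc n))))

Σ≤-*ʳ : ∀ n c f → Σ≤ n (λ i → f i ℤ.* c) ≡ Σ≤ n f ℤ.* c
Σ≤-*ʳ n c f = trans (Σ≤-cong n (λ i _ → ℤ.*-comm (f i) c)) (trans (Σ≤-*ˡ n c f) (ℤ.*-comm c (Σ≤ n f)))

Σ≤-suc : ∀ n f → Σ≤ (suc n) f ≡ f 0 ℤ.+ Σ≤ n (λ i → f (suc i))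
Σ≤-suc zero    f = refl
Σ≤-suc (suc n) f = trans (cong (ℤ._+ f (suc (suc n))) (Σ≤-suc n f)) (ℤ.+-assoc (f 0) _ _)

Σ≤-reverse : ∀ n f → Σ≤ n f ≡ Σ≤ n (λ i → f (n ∸ i))
Σ≤-reverse zero    f = refl
Σ≤-reverse (suc n) f = begin
  Σ≤ n f ℤ.+ f (suc n)                       ≡⟨ ℤ.+-comm (Σ≤ n f) _ ⟩
  f (suc n) ℤ.+ Σ≤ n f                       ≡⟨ cong (λ x → f (suc n) ℤ.+ x) (Σ≤-reverse n f) ⟩
  f (suc n) ℤ.+ Σ≤ n (λ i → f (n ∸ i))       ≡⟨ Σ≤-suc n (λ i → f (suc n ∸ i)) ⟨
  Σ≤ (suc n) (λ i → f (suc n ∸ i))           ∎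
  where open ≡-Reasoning

-- Both sides sum G a b c over all a + b + c = n.
Σ≤-triangle : ∀ n (G : ℕ → ℕ → ℕ → ℤ) →
  Σ≤ n (λ i → Σ≤ i (λ j → G j (i ∸ j) (n ∸ i))) ≡ Σ≤ n (λ j → Σ≤ (n ∸ j) (λ r → G j r (n ∸ j ∸ r)))
Σ≤-triangle zero    G = refl
Σ≤-triangle (suc n) G = begin
  Σ≤ n (λ i → Σ≤ i (λ j → G j (i ∸ j) (suc n ∸ i))) ℤ.+ Σ≤ (suc n) (λ j → G j (suc n ∸ j) (n ∸ n))
    ≡⟨ cong₂ ℤ._+_ (Σ≤-cong n (λ i i≤n → Σ≤-cong i (λ j _ → cong (G j (i ∸ j)) (+-∸-assoc 1 i≤n))))
                   (Σ≤-cong (suc n) (λ j _ → cong (G j (suc n ∸ j)) (n∸n≡0 n))) ⟩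
  Σ≤ n (λ i → Σ≤ i (λ j → G′ j (i ∸ j) (n ∸ i))) ℤ.+ (D ℤ.+ G (suc n) (n ∸ n) 0)
    ≡⟨ cong₂ (λ x y → x ℤ.+ (D ℤ.+ G (suc n) y 0)) (Σ≤-triangle n G′) (n∸n≡0 n) ⟩
  U′ ℤ.+ (D ℤ.+ G (suc n) 0 0)
    ≡⟨ trans (cong (ℤ._+ G (suc n) 0 0) (Σ≤-+ n _ _)) (ℤ.+-assoc U′ D (G (suc n) 0 0)) ⟨
  Σ≤ n (λ j → Σ≤ (n ∸ j) (λ r → G′ j r (n ∸ j ∸ r)) ℤ.+ G j (suc n ∸ j) 0) ℤ.+ G (suc n) 0 0
    ≡⟨ cong₂ ℤ._+_ (Σ≤-cong n (λ j j≤n → sym (inner j j≤n)))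
                   (cong (λ x → Σ≤ x (λ r → G (suc n) r (x ∸ r))) (sym (n∸n≡0 n))) ⟩
  Σ≤ n (λ j → Σ≤ (suc n ∸ j) (λ r → G j r (suc n ∸ j ∸ r)))
    ℤ.+ Σ≤ (n ∸ n) (λ r → G (suc n) r (n ∸ n ∸ r)) ∎
  where
  open ≡-Reasoning
  G′ : ℕ → ℕ → ℕ → ℤ
  G′ a b c = G a b (suc c)
  U′ D : ℤ
  U′ = Σ≤ n (λ j → Σ≤ (n ∸ j) (λ r → G′ j r (n ∸ j ∸ r)))
  D  = Σ≤ n (λ j → G j (suc n ∸ j) 0)
  inner : ∀ j → j ≤ n → Σ≤ (suc n ∸ j) (λ r → G j r (suc n ∸ j ∸ r))
                      ≡ Σ≤ (n ∸ j) (λ r → G′ j r (n ∸ j ∸ r)) ℤ.+ G j (suc n ∸ j) 0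
  inner j j≤n rewrite +-∸-assoc 1 j≤n =
    cong₂ ℤ._+_ (Σ≤-cong (n ∸ j) (λ r r≤ → cong (G j r) (+-∸-assoc 1 r≤)))
                (cong (G j (suc (n ∸ j))) (n∸n≡0 (n ∸ j)))

infix 4 _≋_
record _≋_ (f g : FPS) : Set where
  constructor coeffwise
  field coeff : ∀ n → f n ≡ g n
open _≋_ public

≋-refl : ∀ {f} → f ≋ f
≋-refl = coeffwise (λ _ → refl)

≋-sym : ∀ {f g} → f ≋ g → g ≋ f
≋-sym (coeffwise f≡g) = coeffwise (λ n → sym (f≡g n))

≋-trans : ∀ {f g h} → f ≋ g → g ≋ h → f ≋ h
≋-trans (coeffwise f≡g) (coeffwise g≡h) = coeffwise (λ n → trans (f≡g n) (g≡h n))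

≡⇒≋ : ∀ {f g} → f ≡ g → f ≋ g
≡⇒≋ refl = ≋-refl

infixl 6 _⊖_
_⊖_ : FPS → FPS → FPS
(f ⊖ g) n = f n ℤ.- g n

⊕-cong : ∀ {f f′ g g′} → f ≋ f′ → g ≋ g′ → f ⊕ g ≋ f′ ⊕ g′
⊕-cong (coeffwise f≡f′) (coeffwise g≡g′) = coeffwise (λ n → cong₂ ℤ._+_ (f≡f′ n) (g≡g′ n))

⊗-cong : ∀ {f f′ g g′} → f ≋ f′ → g ≋ g′ → f ⊗ g ≋ f′ ⊗ g′
⊗-cong (coeffwise f≡f′) (coeffwise g≡g′) =
  coeffwise (λ n → Σ≤-cong n (λ i _ → cong₂ ℤ._*_ (f≡f′ i) (g≡g′ (n ∸ i))))

⊗-congˡ : ∀ {f f′} g → f ≋ f′ → f ⊗ g ≋ f′ ⊗ g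
⊗-congˡ g f≋f′ = ⊗-cong f≋f′ (≋-refl {g})

⊗-congʳ : ∀ f {g g′} → g ≋ g′ → f ⊗ g ≋ f ⊗ g′
⊗-congʳ f g≋g′ = ⊗-cong (≋-refl {f}) g≋g′

⊗-comm : ∀ f g → f ⊗ g ≋ g ⊗ f
⊗-comm f g = coeffwise λ n → trans (Σ≤-reverse n _) (Σ≤-cong n (λ i i≤n →
  trans (cong (λ j → f (n ∸ i) ℤ.* g j) (m∸[m∸n]≡n i≤n)) (ℤ.*-comm (f (n ∸ i)) (g i))))

⊗-assoc : ∀ f g h → (f ⊗ g) ⊗ h ≋ f ⊗ (g ⊗ h)
⊗-assoc f g h = coeffwise λ n → begin
  ((f ⊗ g) ⊗ h) n
    ≡⟨ Σ≤-cong n (λ i _ → sym (Σ≤-*ʳ i (h (n ∸ i)) _)) ⟩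
  Σ≤ n (λ i → Σ≤ i (λ j → fgh j (i ∸ j) (n ∸ i)))
    ≡⟨ Σ≤-triangle n fgh ⟩
  Σ≤ n (λ j → Σ≤ (n ∸ j) (λ r → fgh j r (n ∸ j ∸ r)))
    ≡⟨ Σ≤-cong n (λ j _ → trans (Σ≤-cong (n ∸ j) (λ r _ → ℤ.*-assoc (f j) (g r) _))
                                (Σ≤-*ˡ (n ∸ j) (f j) _)) ⟩
  (f ⊗ (g ⊗ h)) n ∎
  where
  open ≡-Reasoning
  fgh : ℕ → ℕ → ℕ → ℤ
  fgh a b c = f a ℤ.* g b ℤ.* h c

⊗-identityˡ : ∀ f → oneS ⊗ f ≋ f
⊗-identityˡ f = coeffwise coeff-identity
  where
  open ≡-Reasoning
  coeff-identity : ∀ n → (oneS ⊗ f) n ≡ f n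
  coeff-identity zero    = ℤ.*-identityˡ (f 0)
  coeff-identity (suc n) = begin
    Σ≤ (suc n) (λ i → oneS i ℤ.* f (suc n ∸ i))
      ≡⟨ Σ≤-suc n _ ⟩
    + 1 ℤ.* f (suc n) ℤ.+ Σ≤ n (λ i → + 0 ℤ.* f (n ∸ i))
      ≡⟨ cong₂ ℤ._+_ (ℤ.*-identityˡ (f (suc n))) (Σ≤-zero n (λ _ _ → refl)) ⟩
    f (suc n) ℤ.+ + 0
      ≡⟨ ℤ.+-identityʳ (f (suc n)) ⟩
    f (suc n) ∎

⊗-identityʳ : ∀ f → f ⊗ oneS ≋ f
⊗-identityʳ f = ≋-trans (⊗-comm f oneS) (⊗-identityˡ f)

⊗-distribˡ-⊕ : ∀ f g h → f ⊗ (g ⊕ h) ≋ (f ⊗ g) ⊕ (f ⊗ h)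
⊗-distribˡ-⊕ f g h = coeffwise λ n →
  trans (Σ≤-cong n (λ i _ → ℤ.*-distribˡ-+ (f i) (g (n ∸ i)) (h (n ∸ i)))) (Σ≤-+ n _ _)

⊗-distribʳ-⊕ : ∀ f g h → (g ⊕ h) ⊗ f ≋ (g ⊗ f) ⊕ (h ⊗ f)
⊗-distribʳ-⊕ f g h = ≋-trans (⊗-comm (g ⊕ h) f)
  (≋-trans (⊗-distribˡ-⊕ f g h) (⊕-cong (⊗-comm f g) (⊗-comm f h)))

⊗-distribˡ-⊖ : ∀ f g h → f ⊗ (g ⊖ h) ≋ (f ⊗ g) ⊖ (f ⊗ h)
⊗-distribˡ-⊖ f g h = coeffwise λ n →
  trans (Σ≤-cong n (λ i _ → distrib (f i) (g (n ∸ i)) (h (n ∸ i)))) (Σ≤-- n _ _)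
  where
  distrib : ∀ a b c → a ℤ.* (b ℤ.- c) ≡ a ℤ.* b ℤ.- a ℤ.* c
  distrib = solve-∀

⊗-distribʳ-⊖ : ∀ f g h → (g ⊖ h) ⊗ f ≋ (g ⊗ f) ⊖ (h ⊗ f)
⊗-distribʳ-⊖ f g h = coeffwise λ n → trans (coeff (⊗-comm (g ⊖ h) f) n)
  (trans (coeff (⊗-distribˡ-⊖ f g h) n) (cong₂ ℤ._-_ (coeff (⊗-comm f g) n) (coeff (⊗-comm f h) n)))

⊗-commutativeMonoid : CommutativeMonoid 0ℓ 0ℓ
⊗-commutativeMonoid = record
  { Carrier = FPS ; _≈_ = _≋_ ; _∙_ = _⊗_ ; ε = oneS
  ; isCommutativeMonoid = record
    { isMonoid = record
      { isSemigroup = record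
        { isMagma = record
          { isEquivalence = record { refl = ≋-refl ; sym = ≋-sym ; trans = ≋-trans }
          ; ∙-cong = ⊗-cong }
        ; assoc = ⊗-assoc }
      ; identity = ⊗-identityˡ , ⊗-identityʳ }
    ; comm = ⊗-comm } }

open import Algebra.Solver.CommutativeMonoid ⊗-commutativeMonoid using (solve; _⊜_) renaming (_⊕_ to _·_)

⊗-interchange : ∀ a b c d → (a ⊗ b) ⊗ (c ⊗ d) ≋ (a ⊗ c) ⊗ (b ⊗ d)
⊗-interchange = solve 4 (λ a b c d → (a · b) · (c · d) ⊜ (a · c) · (b · d)) ≋-refl

data Offset (e : ℕ) : ℕ → Set where
  below : ∀ {n} → n < e → Offset e n
  above : ∀ r → Offset e (e + r)

offset : ∀ e n → Offset e n
offset zero    n       = above n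
offset (suc e) zero    = below (s≤s z≤n)
offset (suc e) (suc n) with offset e n
... | below n<e = below (s≤s n<e)
... | above r   = above r

offset-above : ∀ e r → offset e (e + r) ≡ above r
offset-above zero    r = refl
offset-above (suc e) r rewrite offset-above e r = refl

qPow-below : ∀ {e n} → n < e → qPow e n ≡ + 0
qPow-below {suc e} {zero}  _           = refl
qPow-below {suc e} {suc n} (s≤s n<e) = qPow-below n<e

qPow-above : ∀ e d r → qPow (e + d) (e + r) ≡ qPow d r
qPow-above zero    d r = refl
qPow-above (suc e) d r = qPow-above e d r

qPow-zero : qPow 0 ≋ oneS
qPow-zero = coeffwise λ { zero → refl ; (suc _) → refl }

qPow⊗-above : ∀ e f r → (qPow e ⊗ f) (e + r) ≡ f r
qPow⊗-above zero    f r =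
  trans (Σ≤-cong r (λ i _ → cong (ℤ._* f (r ∸ i)) (coeff qPow-zero i))) (coeff (⊗-identityˡ f) r)
qPow⊗-above (suc e) f r = trans (Σ≤-suc (e + r) _) (trans (ℤ.+-identityˡ _) (qPow⊗-above e f r))

qPow⊗-below : ∀ e f {n} → n < e → (qPow e ⊗ f) n ≡ + 0
qPow⊗-below e f {n} n<e =
  Σ≤-zero n (λ i i≤n → cong (ℤ._* f (n ∸ i)) (qPow-below (≤-<-trans i≤n n<e)))

qPow⊗qPow : ∀ e d → qPow e ⊗ qPow d ≋ qPow (e + d)
qPow⊗qPow e d = coeffwise coeff-product
  where
  coeff-product : ∀ n → (qPow e ⊗ qPow d) n ≡ qPow (e + d) n
  coeff-product n with offset e n
  ... | below n<e = trans (qPow⊗-below e (qPow d) n<e) (sym (qPow-below (<-≤-trans n<e (m≤m+n e d))))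
  ... | above r   = trans (qPow⊗-above e (qPow d) r) (sym (qPow-above e d r))

oneMinusQPow-+ : ∀ a b → oneMinusQPow (b + a) ≋ oneMinusQPow b ⊕ (qPow b ⊗ oneMinusQPow a)
oneMinusQPow-+ a b = coeffwise λ n → begin
  oneS n ℤ.- qPow (b + a) n
    ≡⟨ telescope (oneS n) (qPow b n) (qPow (b + a) n) ⟩
  (oneS n ℤ.- qPow b n) ℤ.+ (qPow b n ℤ.- qPow (b + a) n)
    ≡⟨ cong (λ x → (oneS n ℤ.- qPow b n) ℤ.+ x) (sym (coeff qb⊗[1-qa] n)) ⟩
  (oneS n ℤ.- qPow b n) ℤ.+ (qPow b ⊗ oneMinusQPow a) n ∎
  where
  open ≡-Reasoning
  telescope : ∀ x y z → x ℤ.- z ≡ (x ℤ.- y) ℤ.+ (y ℤ.- z)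
  telescope = solve-∀
  qb⊗[1-qa] : qPow b ⊗ oneMinusQPow a ≋ qPow b ⊖ qPow (b + a)
  qb⊗[1-qa] = ≋-trans (⊗-distribˡ-⊖ (qPow b) oneS (qPow a))
    (coeffwise λ n → cong₂ ℤ._-_ (coeff (⊗-identityʳ (qPow b)) n) (coeff (qPow⊗qPow b a) n))

oneMinusQPow⊗geomInv : ∀ j → oneMinusQPow (suc j) ⊗ geomInv (suc j) ≋ oneS
oneMinusQPow⊗geomInv j = ≋-trans (⊗-distribʳ-⊖ G oneS (qPow (suc j))) (coeffwise coeff-inverse)
  where
  G = geomInv (suc j)
  coeff-inverse : ∀ n → (oneS ⊗ G) n ℤ.- (qPow (suc j) ⊗ G) n ≡ oneS n
  coeff-inverse n rewrite coeff (⊗-identityˡ G) n with offset (suc j) n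
  coeff-inverse zero    | below _ = refl
  coeff-inverse (suc n) | below n<j
    rewrite qPow⊗-below (suc j) G n<j | dec-false (suc j ∣? suc n) (λ j∣n → <⇒≱ n<j (∣⇒≤ j∣n)) = refl
  coeff-inverse _ | above r
    rewrite qPow⊗-above (suc j) G r
          | does-⇔ (mk⇔ (λ j∣j+r → ∣m+n∣m⇒∣n j∣j+r ∣-refl) (∣m∣n⇒∣m+n ∣-refl))
                   (suc j ∣? (suc j + r)) (suc j ∣? r)
    = ℤ.+-inverseʳ (G r)

qPoch⊗qPochInv : ∀ m → qPoch m ⊗ qPochInv (+ m) ≋ oneS
qPoch⊗qPochInv zero    = ⊗-identityˡ oneS
qPoch⊗qPochInv (suc m) = ≋-trans (⊗-interchange (qPoch m) (oneMinusQPow (suc m)) (qPochInv (+ m)) (geomInv (suc m)))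
  (≋-trans (⊗-cong (qPoch⊗qPochInv m) (oneMinusQPow⊗geomInv m)) (⊗-identityˡ oneS))

-- The generating function of partitions in an a × b box, given by the q-Pascal recurrence.
boxSeries : ℕ → ℕ → FPS
boxSeries zero    b       = oneS
boxSeries (suc a) zero    = oneS
boxSeries (suc a) (suc b) = boxSeries (suc a) b ⊕ (qPow (suc b) ⊗ boxSeries a (suc b))

boxSeries⊗qPochs : ∀ a b → boxSeries a b ⊗ (qPoch a ⊗ qPoch b) ≋ qPoch (a + b)
boxSeries⊗qPochs zero    b       = ≋-trans (⊗-identityˡ _) (⊗-identityˡ (qPoch b))
boxSeries⊗qPochs (suc a) zero    = ≋-trans (⊗-identityˡ _)
  (≋-trans (⊗-identityʳ (qPoch (suc a))) (≡⇒≋ (cong qPoch (sym (+-identityʳ (suc a))))))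
boxSeries⊗qPochs (suc a) (suc b) = begin
  (B₁ ⊕ (Q ⊗ B₂)) ⊗ (Pa′ ⊗ Pb′)
    ≈⟨ ⊗-distribʳ-⊕ (Pa′ ⊗ Pb′) B₁ (Q ⊗ B₂) ⟩
  (B₁ ⊗ (Pa′ ⊗ Pb′)) ⊕ ((Q ⊗ B₂) ⊗ (Pa′ ⊗ Pb′))
    ≈⟨ ⊕-cong regroup₁ regroup₂ ⟩
  ((B₁ ⊗ (Pa′ ⊗ Pb)) ⊗ u) ⊕ ((B₂ ⊗ (Pa ⊗ Pb′)) ⊗ (Q ⊗ v))
    ≈⟨ ⊕-cong (⊗-congˡ u IH₁) (⊗-congˡ (Q ⊗ v) (boxSeries⊗qPochs a (suc b))) ⟩
  (X ⊗ u) ⊕ (X ⊗ (Q ⊗ v))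
    ≈⟨ ⊗-distribˡ-⊕ X u (Q ⊗ v) ⟨
  X ⊗ (u ⊕ (Q ⊗ v))
    ≈⟨ ⊗-congʳ X (oneMinusQPow-+ (suc a) (suc b)) ⟨
  X ⊗ oneMinusQPow (suc b + suc a)
    ≡⟨ cong (λ e → X ⊗ oneMinusQPow e) (+-comm (suc b) (suc a)) ⟩
  qPoch (suc a + suc b) ∎
  where
  open import Relation.Binary.Reasoning.Setoid (CommutativeMonoid.setoid ⊗-commutativeMonoid)
  B₁ = boxSeries (suc a) b
  B₂ = boxSeries a (suc b)
  Q  = qPow (suc b)
  u  = oneMinusQPow (suc b)
  v  = oneMinusQPow (suc a)
  Pa = qPoch a
  Pb = qPoch b
  Pa′ = qPoch (suc a)
  Pb′ = qPoch (suc b)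
  X  = qPoch (a + suc b)
  IH₁ : B₁ ⊗ (Pa′ ⊗ Pb) ≋ X
  IH₁ = ≋-trans (boxSeries⊗qPochs (suc a) b) (≡⇒≋ (cong qPoch (sym (+-suc a b))))
  regroup₁ : B₁ ⊗ (Pa′ ⊗ (Pb ⊗ u)) ≋ (B₁ ⊗ (Pa′ ⊗ Pb)) ⊗ u
  regroup₁ = solve 4 (λ B₁ Pa′ Pb u → B₁ · (Pa′ · (Pb · u)) ⊜ (B₁ · (Pa′ · Pb)) · u) ≋-refl B₁ Pa′ Pb u
  regroup₂ : (Q ⊗ B₂) ⊗ ((Pa ⊗ v) ⊗ Pb′) ≋ (B₂ ⊗ (Pa ⊗ Pb′)) ⊗ (Q ⊗ v)
  regroup₂ = solve 5 (λ Q B₂ Pa v Pb′ → (Q · B₂) · ((Pa · v) · Pb′) ⊜ (B₂ · (Pa · Pb′)) · (Q · v))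
                     ≋-refl Q B₂ Pa v Pb′

gaussBinom≋boxSeries : ∀ a b → gaussBinom (a + b) b ≋ boxSeries a b
gaussBinom≋boxSeries a b = begin
  (qPoch (a + b) ⊗ Ib) ⊗ qPochInv (+ (a + b) ℤ.- + b)
    ≡⟨ cong (λ i → (qPoch (a + b) ⊗ Ib) ⊗ qPochInv i) (trans (cong (ℤ._- + b) (ℤ.pos-+ a b)) (cancel (+ a) (+ b))) ⟩
  (qPoch (a + b) ⊗ Ib) ⊗ Ia
    ≈⟨ ⊗-congˡ Ia (⊗-congˡ Ib (boxSeries⊗qPochs a b)) ⟨
  ((boxSeries a b ⊗ (qPoch a ⊗ qPoch b)) ⊗ Ib) ⊗ Ia
    ≈⟨ solve 5 (λ B Pa Pb Ib Ia → ((B · (Pa · Pb)) · Ib) · Ia ⊜ B · ((Pa · Ia) · (Pb · Ib))) ≋-refl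
               (boxSeries a b) (qPoch a) (qPoch b) Ib Ia ⟩
  boxSeries a b ⊗ ((qPoch a ⊗ Ia) ⊗ (qPoch b ⊗ Ib))
    ≈⟨ ⊗-congʳ (boxSeries a b) (⊗-cong (qPoch⊗qPochInv a) (qPoch⊗qPochInv b)) ⟩
  boxSeries a b ⊗ (oneS ⊗ oneS)
    ≈⟨ ⊗-congʳ (boxSeries a b) (⊗-identityˡ oneS) ⟩
  boxSeries a b ⊗ oneS
    ≈⟨ ⊗-identityʳ (boxSeries a b) ⟩
  boxSeries a b ∎
  where
  open import Relation.Binary.Reasoning.Setoid (CommutativeMonoid.setoid ⊗-commutativeMonoid)
  Ia = qPochInv (+ a)
  Ib = qPochInv (+ b)
  cancel : ∀ x y → x ℤ.+ y ℤ.- y ≡ x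
  cancel = solve-∀

Fibre : {X Y : Set} → (X → Set) → (X → Y) → Y → Set
Fibre {X} P f y = Σ X (λ x → P x × f x ≡ y)

record Enumeration {X : Set} (P : X → Set) (w : X → ℕ) (c : FPS) : Set₁ where
  field
    ofWeight : ℕ → List X
    unique   : ∀ n → Unique (ofWeight n)
    sound    : ∀ {n x} → x ∈ ofWeight n → P x × w x ≡ n
    complete : ∀ {x} → P x → x ∈ ofWeight (w x)
    count    : ∀ n → + length (ofWeight n) ≡ c n
open Enumeration

module _ {X : Set} {P : X → Set} {w : X → ℕ} where

  enum-resp-≋ : ∀ {c d} → c ≋ d → Enumeration P w c → Enumeration P w d
  enum-resp-≋ c≋d A = record
    { ofWeight = ofWeight A ; unique = unique A ; sound = sound A ; complete = complete A
    ; count = λ n → trans (count A n) (coeff c≋d n) }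

  enum-resp-⇔ : ∀ {Q : X → Set} {c} → (∀ {x} → P x → Q x) → (∀ {x} → Q x → P x) →
                Enumeration P w c → Enumeration Q w c
  enum-resp-⇔ P⇒Q Q⇒P A = record
    { ofWeight = ofWeight A ; unique = unique A ; count = count A
    ; sound = λ x∈ → map₁ P⇒Q (sound A x∈) ; complete = λ qx → complete A (Q⇒P qx) }

  union-enum : ∀ {Q : X → Set} {c d} → Enumeration P w c → Enumeration Q w d → (∀ {x} → P x → Q x → ⊥) →
               Enumeration (λ x → P x ⊎ Q x) w (c ⊕ d)
  union-enum {Q = Q} A B disjoint = record
    { ofWeight = λ n → ofWeight A n ++ ofWeight B n
    ; unique   = λ n → Unique.++⁺ (unique A n) (unique B n)
                         (λ (a , b) → disjoint (proj₁ (sound A a)) (proj₁ (sound B b)))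
    ; sound    = sound′
    ; complete = λ { (inj₁ p) → ∈-++⁺ˡ (complete A p) ; {x} (inj₂ q) → ∈-++⁺ʳ (ofWeight A (w x)) (complete B q) }
    ; count    = λ n → trans (cong +_ (length-++ (ofWeight A n)))
                             (trans (ℤ.pos-+ (length (ofWeight A n)) _) (cong₂ ℤ._+_ (count A n) (count B n))) }
    where
    sound′ : ∀ {n x} → x ∈ ofWeight A n ++ ofWeight B n → (P x ⊎ Q x) × w x ≡ n
    sound′ {n} x∈ with ∈-++⁻ (ofWeight A n) x∈
    ... | inj₁ x∈A = map₁ inj₁ (sound A x∈A)
    ... | inj₂ x∈B = map₁ inj₂ (sound B x∈B)

  -- The series is written with if-then-else so that qPow and geomInv are instances up to definitional equality.
  subsingleton-enum : (decide : ∀ n → Dec (Fibre P w n)) → (∀ {x y} → P x → P y → w x ≡ w y → x ≡ y) →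
                      Enumeration P w (λ n → if does (decide n) then + 1 else + 0)
  subsingleton-enum decide injective = record
    { ofWeight = λ n → witnesses (decide n)
    ; unique   = λ n → unique′ (decide n)
    ; sound    = λ {n} → sound′ (decide n)
    ; complete = complete′
    ; count    = λ n → count′ (decide n) }
    where
    witnesses : ∀ {n} → Dec (Fibre P w n) → List X
    witnesses (yes (x , _)) = x ∷ []
    witnesses (no _)        = []
    unique′ : ∀ {n} (d : Dec (Fibre P w n)) → Unique (witnesses d)
    unique′ (yes _) = [] ∷ []
    unique′ (no _)  = []
    sound′ : ∀ {n x} (d : Dec (Fibre P w n)) → x ∈ witnesses d → P x × w x ≡ n
    sound′ (yes (_ , px , wx≡n)) (here refl) = px , wx≡n
    complete′ : ∀ {x} → P x → x ∈ witnesses (decide (w x))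
    complete′ {x} px with decide (w x)
    ... | yes (y , py , wy≡wx) = here (injective px py (sym wy≡wx))
    ... | no ¬fibre            = ⊥-elim (¬fibre (x , px , refl))
    count′ : ∀ {n} (d : Dec (Fibre P w n)) → + length (witnesses d) ≡ (if does d then + 1 else + 0)
    count′ (yes _) = refl
    count′ (no _)  = refl

  empty-enum : (∀ {x} → ¬ P x) → Enumeration P w zeroS
  empty-enum ¬P = record
    { ofWeight = λ _ → [] ; unique = λ _ → [] ; sound = λ () ; count = λ _ → refl
    ; complete = λ px → ⊥-elim (¬P px) }

  singleton-enum : (x₀ : X) → P x₀ → (∀ {x} → P x → x ≡ x₀) → Enumeration P w (qPow (w x₀))
  singleton-enum x₀ px₀ only-x₀ = subsingleton-enum
    (λ n → map′ (λ n≡wx₀ → x₀ , px₀ , sym n≡wx₀)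
                (λ (x , px , wx≡n) → trans (sym wx≡n) (cong w (only-x₀ px)))
                (n ≟ w x₀))
    (λ px py _ → trans (only-x₀ px) (sym (only-x₀ py)))

  shift-enum : ∀ {c} e → Enumeration P w c → Enumeration P (λ x → e + w x) (qPow e ⊗ c)
  shift-enum {c} e A = record
    { ofWeight = λ n → shifted (offset e n)
    ; unique   = λ n → unique′ (offset e n)
    ; sound    = λ {n} → sound′ (offset e n)
    ; complete = complete′
    ; count    = λ n → count′ (offset e n) }
    where
    shifted : ∀ {n} → Offset e n → List X
    shifted (below _) = []
    shifted (above r) = ofWeight A r
    unique′ : ∀ {n} (o : Offset e n) → Unique (shifted o)
    unique′ (below _) = []
    unique′ (above r) = unique A r
    sound′ : ∀ {n x} (o : Offset e n) → x ∈ shifted o → P x × e + w x ≡ n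
    sound′ (above r) x∈ = map₂ (cong (_+_ e)) (sound A x∈)
    complete′ : ∀ {x} → P x → x ∈ shifted (offset e (e + w x))
    complete′ {x} px rewrite offset-above e (w x) = complete A px
    count′ : ∀ {n} (o : Offset e n) → + length (shifted o) ≡ (qPow e ⊗ c) n
    count′ (below n<e) = sym (qPow⊗-below e c n<e)
    count′ (above r)   = trans (count A r) (sym (qPow⊗-above e c r))

multiples-enum : ∀ j → Enumeration {ℕ} (λ _ → ⊤) (suc j *_) (geomInv (suc j))
multiples-enum j = subsingleton-enum
  (λ n → map′ (λ (divides q n≡q*j) → q , tt , trans (*-comm (suc j) q) (sym n≡q*j))
              (λ (q , _ , j*q≡n) → divides q (trans (sym j*q≡n) (*-comm (suc j) q)))
              (suc j ∣? n))
  (λ {x} {y} _ _ j*x≡j*y → *-cancelˡ-≡ x y (suc j) j*x≡j*y)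

Unique-map⁺ : ∀ {X Y : Set} (f : X → Y) {xs} → (∀ {a b} → a ∈ xs → b ∈ xs → f a ≡ f b → a ≡ b) →
              Unique xs → Unique (map f xs)
Unique-map⁺ f injective []           = []
Unique-map⁺ f injective (x∉xs ∷ uxs) =
  All.map⁺ (All.tabulate (λ y∈xs fx≡fy → All.lookup x∉xs y∈xs (injective (here refl) (there y∈xs) fx≡fy)))
  ∷ Unique-map⁺ f (λ a∈ b∈ → injective (there a∈) (there b∈)) uxs

image-enum : ∀ {X Y : Set} {P : X → Set} {w : X → ℕ} {c} (f : X → Y) (w′ : Y → ℕ) →
             (∀ {x} → P x → w′ (f x) ≡ w x) → (∀ {x y} → P x → P y → f x ≡ f y → x ≡ y) →
             Enumeration P w c → Enumeration (Fibre P f) w′ c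
image-enum {P = P} {w} f w′ weight-f injective A = record
  { ofWeight = λ n → map f (ofWeight A n)
  ; unique   = λ n → Unique-map⁺ f (λ a∈ b∈ → injective (proj₁ (sound A a∈)) (proj₁ (sound A b∈))) (unique A n)
  ; sound    = sound′
  ; complete = complete′
  ; count    = λ n → trans (cong +_ (length-map f (ofWeight A n))) (count A n) }
  where
  sound′ : ∀ {n y} → y ∈ map f (ofWeight A n) → Fibre P f y × w′ y ≡ n
  sound′ y∈ with ∈-map⁻ f y∈
  ... | x , x∈ , refl = (x , proj₁ (sound A x∈) , refl) , trans (weight-f (proj₁ (sound A x∈))) (proj₂ (sound A x∈))
  complete′ : ∀ {y} → Fibre P f y → y ∈ map f (ofWeight A (w′ y))
  complete′ (x , px , refl) rewrite weight-f px = ∈-map⁺ f (complete A px)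

length-cartesianProduct : ∀ {X Y : Set} (xs : List X) (ys : List Y) →
                          length (cartesianProduct xs ys) ≡ length xs * length ys
length-cartesianProduct []       ys = refl
length-cartesianProduct (x ∷ xs) ys =
  trans (length-++ (map (x ,_) ys)) (cong₂ _+_ (length-map (x ,_) ys) (length-cartesianProduct xs ys))

module _ {X Y : Set} {P : X → Set} {Q : Y → Set} {w : X → ℕ} {v : Y → ℕ} {c d : FPS}
         (A : Enumeration P w c) (B : Enumeration Q v d) where

  private
    block : ℕ → ℕ → List (X × Y)
    block n i = cartesianProduct (ofWeight A i) (ofWeight B (n ∸ i))

    pairsUpTo : ℕ → ℕ → List (X × Y)
    pairsUpTo n zero    = block n 0
    pairsUpTo n (suc j) = pairsUpTo n j ++ block n (suc j)

    ∈-pairsUpTo⁻ : ∀ n j {x y} → (x , y) ∈ pairsUpTo n j →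
                   ∃[ i ] i ≤ j × x ∈ ofWeight A i × y ∈ ofWeight B (n ∸ i)
    ∈-pairsUpTo⁻ n zero    xy∈ = 0 , z≤n , ∈-cartesianProduct⁻ (ofWeight A 0) (ofWeight B n) xy∈
    ∈-pairsUpTo⁻ n (suc j) xy∈ with ∈-++⁻ (pairsUpTo n j) xy∈
    ... | inj₁ xy∈′ = let i , i≤j , x∈ , y∈ = ∈-pairsUpTo⁻ n j xy∈′ in i , m≤n⇒m≤1+n i≤j , x∈ , y∈
    ... | inj₂ xy∈′ = suc j , ≤-refl , ∈-cartesianProduct⁻ (ofWeight A (suc j)) (ofWeight B (n ∸ suc j)) xy∈′

    ∈-pairsUpTo⁺ : ∀ n j i {x y} → i ≤ j → x ∈ ofWeight A i → y ∈ ofWeight B (n ∸ i) → (x , y) ∈ pairsUpTo n j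
    ∈-pairsUpTo⁺ n zero    zero z≤n x∈ y∈ = ∈-cartesianProduct⁺ x∈ y∈
    ∈-pairsUpTo⁺ n (suc j) i    i≤j x∈ y∈ with i ≟ suc j
    ... | yes refl = ∈-++⁺ʳ (pairsUpTo n j) (∈-cartesianProduct⁺ x∈ y∈)
    ... | no i≢j   = ∈-++⁺ˡ (∈-pairsUpTo⁺ n j i (≤-pred (≤∧≢⇒< i≤j i≢j)) x∈ y∈)

    pairsUpTo-unique : ∀ n j → Unique (pairsUpTo n j)
    pairsUpTo-unique n zero    = Unique.cartesianProduct⁺ (unique A 0) (unique B n)
    pairsUpTo-unique n (suc j) = Unique.++⁺ (pairsUpTo-unique n j)
      (Unique.cartesianProduct⁺ (unique A (suc j)) (unique B (n ∸ suc j))) disjoint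
      where
      disjoint : ∀ {p} → ¬ (p ∈ pairsUpTo n j × p ∈ block n (suc j))
      disjoint (p∈ , p∈′) =
        let i , i≤j , x∈ , _ = ∈-pairsUpTo⁻ n j p∈
            x∈′ , _ = ∈-cartesianProduct⁻ (ofWeight A (suc j)) (ofWeight B (n ∸ suc j)) p∈′
        in 1+n≰n (subst (_≤ j) (trans (sym (proj₂ (sound A x∈))) (proj₂ (sound A x∈′))) i≤j)

    block-count : ∀ n i → + length (block n i) ≡ c i ℤ.* d (n ∸ i)
    block-count n i = trans (cong +_ (length-cartesianProduct (ofWeight A i) (ofWeight B (n ∸ i))))
      (trans (ℤ.pos-* (length (ofWeight A i)) _) (cong₂ ℤ._*_ (count A i) (count B (n ∸ i))))

    pairsUpTo-count : ∀ n j → + length (pairsUpTo n j) ≡ Σ≤ j (λ i → c i ℤ.* d (n ∸ i))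
    pairsUpTo-count n zero    = block-count n 0
    pairsUpTo-count n (suc j) = trans (cong +_ (length-++ (pairsUpTo n j)))
      (trans (ℤ.pos-+ (length (pairsUpTo n j)) _) (cong₂ ℤ._+_ (pairsUpTo-count n j) (block-count n (suc j))))

  product-enum : Enumeration (λ p → P (proj₁ p) × Q (proj₂ p)) (λ p → w (proj₁ p) + v (proj₂ p)) (c ⊗ d)
  product-enum = record
    { ofWeight = λ n → pairsUpTo n n
    ; unique   = λ n → pairsUpTo-unique n n
    ; sound    = sound′
    ; complete = complete′
    ; count    = λ n → pairsUpTo-count n n }
    where
    sound′ : ∀ {n p} → p ∈ pairsUpTo n n → (P (proj₁ p) × Q (proj₂ p)) × w (proj₁ p) + v (proj₂ p) ≡ n
    sound′ {n} p∈ =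
      let i , i≤n , x∈ , y∈ = ∈-pairsUpTo⁻ n n p∈
      in (proj₁ (sound A x∈) , proj₁ (sound B y∈)) ,
         trans (cong₂ _+_ (proj₂ (sound A x∈)) (proj₂ (sound B y∈))) (m+[n∸m]≡n i≤n)
    complete′ : ∀ {p} → P (proj₁ p) × Q (proj₂ p) →
                p ∈ pairsUpTo (w (proj₁ p) + v (proj₂ p)) (w (proj₁ p) + v (proj₂ p))
    complete′ {x , y} (px , qy) = ∈-pairsUpTo⁺ _ _ (w x) (m≤m+n (w x) (v y)) (complete A px)
      (subst (λ i → y ∈ ofWeight B i) (sym (m+n∸m≡n (w x) (v y))) (complete B qy))

⋃-enum : ∀ {X : Set} {T : ℕ → X → Set} {w : X → ℕ} {F : ℕ → FPS} j →
         (∀ l → 1 ≤ l → l ≤ j → Enumeration (T l) w (F l)) → (∀ {l l′ x} → T l x → T l′ x → l ≡ l′) →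
         Enumeration (λ x → ∃[ l ] (1 ≤ l × l ≤ j) × T l x) w (ΣS j F)
⋃-enum zero E _ = empty-enum (λ (l , (1≤l , l≤0) , _) → <⇒≱ 1≤l l≤0)
⋃-enum {T = T} (suc j) E same-index = enum-resp-⇔ join split
  (union-enum (⋃-enum j (λ l 1≤l l≤j → E l 1≤l (m≤n⇒m≤1+n l≤j)) same-index)
              (E (suc j) (s≤s z≤n) ≤-refl) disjoint)
  where
  disjoint : ∀ {x} → ∃[ l ] (1 ≤ l × l ≤ j) × T l x → T (suc j) x → ⊥
  disjoint (l , (_ , l≤j) , t) t′ = 1+n≰n (subst (_≤ j) (same-index t t′) l≤j)
  join : ∀ {x} → (∃[ l ] (1 ≤ l × l ≤ j) × T l x) ⊎ T (suc j) x → ∃[ l ] (1 ≤ l × l ≤ suc j) × T l x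
  join (inj₁ (l , (1≤l , l≤j) , t)) = l , (1≤l , m≤n⇒m≤1+n l≤j) , t
  join (inj₂ t)                     = suc j , (s≤s z≤n , ≤-refl) , t
  split : ∀ {x} → ∃[ l ] (1 ≤ l × l ≤ suc j) × T l x → (∃[ l ] (1 ≤ l × l ≤ j) × T l x) ⊎ T (suc j) x
  split (l , (1≤l , l≤1+j) , t) with l ≟ suc j
  ... | yes refl = inj₂ t
  ... | no l≢1+j = inj₁ (l , (1≤l , ≤-pred (≤∧≢⇒< l≤1+j l≢1+j)) , t)

raise : ℕ → List ℕ → List ℕ
raise c = map (_+_ c)

lower : ℕ → List ℕ → List ℕ
lower c = map (_∸ c)

sum-raise : ∀ c y → sum (raise c y) ≡ length y * c + sum y
sum-raise c []      = refl
sum-raise c (x ∷ y) = trans (cong (_+_ (c + x)) (sum-raise c y)) (+-lemma c x (length y * c) (sum y))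
  where
  +-lemma : ∀ c x p s → c + x + (p + s) ≡ c + p + (x + s)
  +-lemma = solveℕ 4 (λ c x p s → c :+ x :+ (p :+ s) := c :+ p :+ (x :+ s)) refl

raise-injective : ∀ c {y y′} → raise c y ≡ raise c y′ → y ≡ y′
raise-injective c = map-injective (+-cancelˡ-≡ c _ _)

raise-lower : ∀ c {A} → All (_≥ c) A → raise c (lower c A) ≡ A
raise-lower c []           = refl
raise-lower c (c≤x ∷ c≤A) = cong₂ _∷_ (m+[n∸m]≡n c≤x) (raise-lower c c≤A)

All-raise : ∀ c y → All (_≥ c) (raise c y)
All-raise c []      = []
All-raise c (x ∷ y) = m≤m+n c x ∷ All-raise c y

Linked-raise : ∀ c {y} → Linked _≥_ y → Linked _≥_ (raise c y)
Linked-raise c = Linked.map⁺ ∘ Linked.map (+-monoʳ-≤ c)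

Linked-lower : ∀ c {A} → Linked _≥_ A → Linked _≥_ (lower c A)
Linked-lower c = Linked.map⁺ ∘ Linked.map (∸-monoˡ-≤ c)

Linked-around⁺ : ∀ {A l r} → All (_≥ l) A → Linked _≥_ A → Linked _≥_ (l ∷ r) → Linked _≥_ (A ++ l ∷ r)
Linked-around⁺ []            []          Llr = Llr
Linked-around⁺ (l≤x ∷ [])    [-]         Llr = l≤x ∷ Llr
Linked-around⁺ (_ ∷ l≤A)     (y≤x ∷ LA) Llr = y≤x ∷ Linked-around⁺ l≤A LA Llr

Linked-around⁻ : ∀ A {l r} → Linked _≥_ (A ++ l ∷ r) → All (_≥ l) A × Linked _≥_ A × Linked _≥_ (l ∷ r)
Linked-around⁻ []          L           = [] , [] , L
Linked-around⁻ (x ∷ [])    (l≤x ∷ L)   = l≤x ∷ [] , [-] , L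
Linked-around⁻ (x ∷ y ∷ A) (y≤x ∷ L) with Linked-around⁻ (y ∷ A) L
... | l≤y ∷ l≤A , LA , Llr = ≤-trans l≤y y≤x ∷ l≤y ∷ l≤A , y≤x ∷ LA , Llr

Linked-bounded : ∀ {l r} → Linked _≥_ (l ∷ r) → All (_≤ l) r
Linked-bounded [-]           = []
Linked-bounded (x≤l ∷ Lxr) = Linked.Linked⇒All (λ y≤x z≤y → ≤-trans z≤y y≤x) x≤l Lxr

NonincreasingOfLength : ℕ → List ℕ → Set
NonincreasingOfLength m y = length y ≡ m × Linked _≥_ y

nonincreasing-enum : ∀ m → Enumeration (NonincreasingOfLength m) sum (qPochInv (+ m))
nonincreasing-enum zero    = enum-resp-≋ qPow-zero (singleton-enum {w = sum} [] (refl , []) (λ { {[]} _ → refl }))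
nonincreasing-enum (suc m) = enum-resp-⇔ fromFibre toFibre
  (image-enum appendMin sum weight injective (product-enum (nonincreasing-enum m) (multiples-enum m)))
  where
  appendMin : List ℕ × ℕ → List ℕ
  appendMin (y , c) = raise c y ∷ʳ c
  Pieces : List ℕ × ℕ → Set
  Pieces p = NonincreasingOfLength m (proj₁ p) × ⊤
  weight : ∀ {p} → Pieces p → sum (appendMin p) ≡ sum (proj₁ p) + suc m * proj₂ p
  weight {y , c} ((refl , _) , _) = begin
    sum (raise c y ++ c ∷ [])             ≡⟨ sum-++ (raise c y) (c ∷ []) ⟩
    sum (raise c y) + (c + 0)             ≡⟨ cong (_+ (c + 0)) (sum-raise c y) ⟩
    length y * c + sum y + (c + 0)        ≡⟨ rearrange (length y) c (sum y) ⟩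
    sum y + suc (length y) * c            ∎
    where
    open ≡-Reasoning
    rearrange : ∀ m c s → m * c + s + (c + 0) ≡ s + (c + m * c)
    rearrange = solveℕ 3 (λ m c s → m :* c :+ s :+ (c :+ con 0) := s :+ (c :+ m :* c)) refl
  injective : ∀ {p p′} → Pieces p → Pieces p′ → appendMin p ≡ appendMin p′ → p ≡ p′
  injective {y , c} {y′ , c′} _ _ eq with ∷ʳ-injective (raise c y) (raise c′ y′) eq
  ... | raise≡ , refl = cong (_, c) (raise-injective c raise≡)
  fromFibre : ∀ {μ} → Fibre Pieces appendMin μ → NonincreasingOfLength (suc m) μ
  fromFibre ((y , c) , ((refl , Ly) , _) , refl) =
    trans (length-++ (raise c y)) (trans (cong (_+ 1) (length-map (_+_ c) y)) (+-comm (length y) 1)) ,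
    Linked-around⁺ (All-raise c y) (Linked-raise c Ly) [-]
  toFibre : ∀ {μ} → NonincreasingOfLength (suc m) μ → Fibre Pieces appendMin μ
  toFibre {μ} _ with initLast μ
  toFibre (() , _)   | []
  toFibre (len , Lμ) | A ∷ʳ′ c with Linked-around⁻ A Lμ
  ... | c≤A , LA , _ = (lower c A , c) , ((lenA , Linked-lower c LA) , tt) , cong (_∷ʳ c) (raise-lower c c≤A)
    where
    lenA : length (lower c A) ≡ m
    lenA = suc-injective (begin
      suc (length (lower c A)) ≡⟨ cong suc (length-map (_∸ c) A) ⟩
      suc (length A)           ≡⟨ +-comm 1 (length A) ⟩
      length A + 1             ≡⟨ length-++ A ⟨
      length (A ∷ʳ c)          ≡⟨ len ⟩
      suc m                    ∎)
      where open ≡-Reasoning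

InBox : ℕ → ℕ → List ℕ → Set
InBox a b z = length z ≡ a × Linked _≥_ z × All (_≤ b) z

InBox-∷ : ∀ {a b z} → InBox a b z → InBox (suc a) b (b ∷ z)
InBox-∷ {z = []}    (len , _ , _)              = cong suc len , [-] , ≤-refl ∷ []
InBox-∷ {z = _ ∷ _} (len , Lz , x≤b ∷ z≤b) = cong suc len , x≤b ∷ Lz , ≤-refl ∷ x≤b ∷ z≤b

InBox-tail : ∀ {a b x z} → InBox (suc a) b (x ∷ z) → InBox a b z
InBox-tail (len , Lxz , _ ∷ z≤b) = suc-injective len , Linked.tail Lxz , z≤b

InBox-shrink : ∀ {a b x z} → InBox a (suc b) (x ∷ z) → x ≤ b → InBox a b (x ∷ z)
InBox-shrink (len , Lxz , _) x≤b = len , Lxz , Linked.Linked⇒All (λ y≤x z≤y → ≤-trans z≤y y≤x) x≤b Lxz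

boxSeries-zero : ∀ a → boxSeries a 0 ≡ oneS
boxSeries-zero zero    = refl
boxSeries-zero (suc a) = refl

-- A sequence in InBox a (b + 1) either has all parts ≤ b or starts with b + 1.
box-enum : ∀ a b → Enumeration (InBox a b) sum (boxSeries a b)
box-enum zero    b       = enum-resp-≋ qPow-zero (singleton-enum {w = sum} [] (refl , [] , []) (λ { {[]} _ → refl }))
box-enum (suc a) zero    = enum-resp-⇔ (λ { (_ , box , refl) → InBox-∷ box }) split
  (enum-resp-≋ (≡⇒≋ (boxSeries-zero a)) (image-enum (0 ∷_) sum (λ _ → refl) (λ _ _ → ∷-injectiveʳ) (box-enum a 0)))
  where
  split : ∀ {z} → InBox (suc a) 0 z → Fibre (InBox a 0) (0 ∷_) z
  split {_ ∷ z} box@(_ , _ , z≤n ∷ _) = z , InBox-tail box , refl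
box-enum (suc a) (suc b) = enum-resp-⇔ join split (union-enum (box-enum (suc a) b)
  (image-enum (suc b ∷_) sum (λ _ → refl) (λ _ _ → ∷-injectiveʳ) (shift-enum (suc b) (box-enum a (suc b)))) disjoint)
  where
  disjoint : ∀ {z} → InBox (suc a) b z → Fibre (InBox a (suc b)) (suc b ∷_) z → ⊥
  disjoint (_ , _ , 1+b≤b ∷ _) (_ , _ , refl) = 1+n≰n 1+b≤b
  join : ∀ {z} → InBox (suc a) b z ⊎ Fibre (InBox a (suc b)) (suc b ∷_) z → InBox (suc a) (suc b) z
  join (inj₁ (len , Lz , z≤b))  = len , Lz , All.map m≤n⇒m≤1+n z≤b
  join (inj₂ (_ , box , refl)) = InBox-∷ box
  split : ∀ {z} → InBox (suc a) (suc b) z → InBox (suc a) b z ⊎ Fibre (InBox a (suc b)) (suc b ∷_) z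
  split {x ∷ z} box@(_ , _ , x≤1+b ∷ _) with x ≟ suc b
  ... | yes refl = inj₂ (z , InBox-tail box , refl)
  ... | no x≢1+b = inj₁ (InBox-shrink box (≤-pred (≤∧≢⇒< x≤1+b x≢1+b)))

++-injective : ∀ {X : Set} (A A′ : List X) {B B′} →
               length A ≡ length A′ → A ++ B ≡ A′ ++ B′ → A ≡ A′ × B ≡ B′
++-injective []      []        _   eq = refl , eq
++-injective (x ∷ A) (x′ ∷ A′) len eq with ∷-injective eq
... | refl , eq′ = map₁ (cong (x ∷_)) (++-injective A A′ (suc-injective len) eq′)

splitAt-index : ∀ (μ : List ℕ) (i : Fin (length μ)) → ∃[ A ] ∃[ r ] μ ≡ A ++ lookup μ i ∷ r × length A ≡ toℕ i
splitAt-index (x ∷ μ) fzero    = [] , μ , refl , refl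
splitAt-index (x ∷ μ) (fsuc i) with splitAt-index μ i
... | A , r , μ≡ , len = x ∷ A , r , cong (x ∷_) μ≡ , cong suc len

lookup-around : ∀ (A : List ℕ) {l r} (i : Fin (length (A ++ l ∷ r))) → toℕ i ≡ length A → lookup (A ++ l ∷ r) i ≡ l
lookup-around []      fzero    _   = refl
lookup-around []      (fsuc i) ()
lookup-around (x ∷ A) fzero    ()
lookup-around (x ∷ A) (fsuc i) eq = lookup-around A i (suc-injective eq)

hook1-≡ : ∀ μ (i : Fin (length μ)) {n} → length μ ≡ toℕ i + suc n → hook1 μ i ≡ + (lookup μ i + n)
hook1-≡ μ i {n} len = begin
  + lookup μ i ℤ.+ (+ length μ ℤ.- + suc (toℕ i))
    ≡⟨ cong (λ t → + lookup μ i ℤ.+ (+ t ℤ.- + suc (toℕ i))) len ⟩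
  + lookup μ i ℤ.+ (+ (toℕ i + suc n) ℤ.- + suc (toℕ i))
    ≡⟨ cong (λ t → + lookup μ i ℤ.+ (t ℤ.- + suc (toℕ i))) (ℤ.pos-+ (toℕ i) (suc n)) ⟩
  + lookup μ i ℤ.+ (+ toℕ i ℤ.+ (+ 1 ℤ.+ + n) ℤ.- (+ 1 ℤ.+ + toℕ i))
    ≡⟨ cong (ℤ._+_ (+ lookup μ i)) (cancel (+ toℕ i) (+ n)) ⟩
  + lookup μ i ℤ.+ + n
    ≡⟨ ℤ.pos-+ (lookup μ i) n ⟨
  + (lookup μ i + n) ∎
  where
  open ≡-Reasoning
  cancel : ∀ t n → t ℤ.+ (+ 1 ℤ.+ n) ℤ.- (+ 1 ℤ.+ t) ≡ n
  cancel = solve-∀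

glue : ℕ → List ℕ → List ℕ → List ℕ
glue l y z = raise l y ++ l ∷ raise 1 z

glue-injective : ∀ {l l′ y y′ z z′} → length y ≡ length y′ →
                 glue l y z ≡ glue l′ y′ z′ → l ≡ l′ × y ≡ y′ × z ≡ z′
glue-injective {l} {l′} {y} {y′} len eq
  with ++-injective (raise l y) (raise l′ y′) (trans (length-map _ y) (trans len (sym (length-map _ y′)))) eq
... | raise≡ , eq′ with ∷-injective eq′
... | refl , raise1≡ = refl , raise-injective l raise≡ , raise-injective 1 raise1≡

glue-positive : ∀ {l} y z → 1 ≤ l → All (0 <_) (glue l y z)
glue-positive {l} y z 1≤l = All.++⁺ (All.map (≤-trans 1≤l) (All-raise l y)) (1≤l ∷ All-raise 1 z)

glue-nonincreasing : ∀ {b y z} → Linked _≥_ y → Linked _≥_ z → All (_≤ b) z → Linked _≥_ (glue (suc b) y z)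
glue-nonincreasing {b} {y} Ly Lz z≤b = Linked-around⁺ (All-raise (suc b) y) (Linked-raise (suc b) Ly) (head Lz z≤b)
  where
  head : ∀ {z} → Linked _≥_ z → All (_≤ b) z → Linked _≥_ (suc b ∷ raise 1 z)
  head []   []         = [-]
  head Lxz (x≤b ∷ _) = s≤s x≤b ∷ Linked-raise 1 Lxz

hook-index : ∀ {h k i} → + suc i ℤ.+ h ≡ + k → + k ℤ.- h ℤ.- + 1 ≡ + i
hook-index {h} {k} {i} eq = trans (cong (λ K → K ℤ.- h ℤ.- + 1) (sym eq)) (cancel (+ i) h)
  where
  cancel : ∀ i h → + 1 ℤ.+ i ℤ.+ h ℤ.- h ℤ.- + 1 ≡ i
  cancel = solve-∀

rhsTerm-nonneg : ∀ {h k m} l → + k ℤ.- h ℤ.- + 1 ≡ + m →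
  rhsTerm h k l ≡ (qPow (k + l * m) ⊗ qPochInv (+ m)) ⊗ gaussBinom (k ∸ 1) (l ∸ 1)
rhsTerm-nonneg {h} {k} l eq with + k ℤ.- h ℤ.- + 1
rhsTerm-nonneg l refl | _ = refl

rhsTerm-negative : ∀ {h k r} l → + k ℤ.- h ℤ.- + 1 ≡ -[1+ r ] → rhsTerm h k l ≡ zeroS
rhsTerm-negative {h} {k} l eq with + k ℤ.- h ℤ.- + 1
rhsTerm-negative l refl | _ = refl

m∸n+[n∸1]≡m∸1 : ∀ {m n} → 1 ≤ n → n ≤ m → m ∸ n + (n ∸ 1) ≡ m ∸ 1
m∸n+[n∸1]≡m∸1 (s≤s z≤n) (s≤s n≤m) = m∸n+n≡m n≤m

FixedHookPartition : ℤ → ℕ → List ℕ → Set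
FixedHookPartition h k μ = All (0 <_) μ × Linked _≥_ μ × HasFixedHookOfSize h k μ

module FixedHook (h : ℤ) (k m : ℕ) (k-h-1≡m : + k ℤ.- h ℤ.- + 1 ≡ + m) where

  hook-size : + suc m ℤ.+ h ≡ + k
  hook-size = trans (cong (λ M → + 1 ℤ.+ M ℤ.+ h) (sym k-h-1≡m)) (cancel (+ k) h)
    where
    cancel : ∀ k h → + 1 ℤ.+ (k ℤ.- h ℤ.- + 1) ℤ.+ h ≡ k
    cancel = solve-∀

  hasFixedHook-around : ∀ A {l r} → length A ≡ m → l + length r ≡ k → HasFixedHookOfSize h k (A ++ l ∷ r)
  hasFixedHook-around A {l} {r} refl l+r≡k = i , trans hook1≡k (sym suc-i+h≡k) , suc-i+h≡k
    where
    A<μ : length A < length (A ++ l ∷ r)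
    A<μ = subst (length A <_) (sym (length-++ A)) (m<m+n (length A) (s≤s z≤n))
    i : Fin (length (A ++ l ∷ r))
    i = fromℕ< A<μ
    suc-i+h≡k : + suc (toℕ i) ℤ.+ h ≡ + k
    suc-i+h≡k = trans (cong (λ j → + suc j ℤ.+ h) (toℕ-fromℕ< A<μ)) hook-size
    hook1≡k : hook1 (A ++ l ∷ r) i ≡ + k
    hook1≡k = begin
      hook1 (A ++ l ∷ r) i
        ≡⟨ hook1-≡ (A ++ l ∷ r) i (trans (length-++ A) (cong (_+ suc (length r)) (sym (toℕ-fromℕ< A<μ)))) ⟩
      + (lookup (A ++ l ∷ r) i + length r)
        ≡⟨ cong (λ x → + (x + length r)) (lookup-around A i (toℕ-fromℕ< A<μ)) ⟩
      + (l + length r)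
        ≡⟨ cong +_ l+r≡k ⟩
      + k ∎
      where open ≡-Reasoning

  hasFixedHook⇒around : ∀ {μ} → HasFixedHookOfSize h k μ →
    ∃[ A ] ∃[ l ] ∃[ r ] μ ≡ A ++ l ∷ r × length A ≡ m × l + length r ≡ k
  hasFixedHook⇒around {μ} (i , hook≡ , suc-i+h≡k) with splitAt-index μ i
  ... | A , r , μ≡ , A≡i = A , lookup μ i , r , μ≡ , trans A≡i i≡m , ℤ.+-injective (begin
    + (lookup μ i + length r)
      ≡⟨ hook1-≡ μ i (trans (cong length μ≡) (trans (length-++ A) (cong (_+ suc (length r)) A≡i))) ⟨
    hook1 μ i                  ≡⟨ trans hook≡ suc-i+h≡k ⟩
    + k                        ∎)
    where
    open ≡-Reasoning
    i≡m : toℕ i ≡ m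
    i≡m = ℤ.+-injective (trans (sym (hook-index {h} suc-i+h≡k)) k-h-1≡m)

  HookPieces : ℕ → List ℕ × List ℕ → Set
  HookPieces l p = NonincreasingOfLength m (proj₁ p) × InBox (k ∸ l) (l ∸ 1) (proj₂ p)

  glued : ℕ → List ℕ × List ℕ → List ℕ
  glued l p = glue l (proj₁ p) (proj₂ p)

  Glued : ℕ → List ℕ → Set
  Glued l = Fibre (HookPieces l) (glued l)

  glued⇒fixedHook : ∀ {l μ} → 1 ≤ l → l ≤ k → Glued l μ → FixedHookPartition h k μ
  glued⇒fixedHook {suc b} 1≤l l≤k ((y , z) , ((lenY , Ly) , (lenZ , Lz , z≤b)) , refl) =
    glue-positive y z 1≤l , glue-nonincreasing Ly Lz z≤b ,
    hasFixedHook-around (raise (suc b) y) (trans (length-map _ y) lenY)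
      (trans (cong (_+_ (suc b)) (trans (length-map _ z) lenZ)) (m+[n∸m]≡n l≤k))

  fixedHook⇒glued : ∀ {μ} → FixedHookPartition h k μ → ∃[ l ] (1 ≤ l × l ≤ k) × Glued l μ
  fixedHook⇒glued {μ} (positive , Lμ , hook) with hasFixedHook⇒around {μ} hook
  ... | A , l , r , refl , lenA , l+r≡k with Linked-around⁻ A Lμ | All.++⁻ʳ A positive
  ... | l≤A , LA , Llr | 1≤l ∷ 1≤r =
    l , (1≤l , subst (l ≤_) l+r≡k (m≤m+n l (length r))) ,
    (lower l A , lower 1 r) ,
    ((trans (length-map _ A) lenA , Linked-lower l LA) ,
     (lenZ , Linked-lower 1 (Linked.tail Llr) , All.map⁺ (All.map (∸-monoˡ-≤ 1) (Linked-bounded Llr)))) ,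
    cong₂ (λ A′ r′ → A′ ++ l ∷ r′) (raise-lower l l≤A) (raise-lower 1 1≤r)
    where
    lenZ : length (lower 1 r) ≡ k ∸ l
    lenZ = trans (length-map _ r) (sym (trans (cong (_∸ l) (sym l+r≡k)) (m+n∸m≡n l (length r))))

  glued-index : ∀ {l l′ μ} → Glued l μ → Glued l′ μ → l ≡ l′
  glued-index (_ , ((lenY , _) , _) , refl) (_ , ((lenY′ , _) , _) , eq) =
    proj₁ (glue-injective (trans lenY (sym lenY′)) (sym eq))

  glued-enum : ∀ l → 1 ≤ l → l ≤ k → Enumeration (Glued l) sum (rhsTerm h k l)
  glued-enum l 1≤l l≤k = enum-resp-≋ series
    (image-enum (glued l) sum weight injective
      (shift-enum (k + l * m) (product-enum (nonincreasing-enum m) (box-enum (k ∸ l) (l ∸ 1)))))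
    where
    weight : ∀ {p} → HookPieces l p → sum (glued l p) ≡ k + l * m + (sum (proj₁ p) + sum (proj₂ p))
    weight {y , z} ((refl , _) , (lenZ , _)) = begin
      sum (raise l y ++ l ∷ raise 1 z)
        ≡⟨ sum-++ (raise l y) (l ∷ raise 1 z) ⟩
      sum (raise l y) + (l + sum (raise 1 z))
        ≡⟨ cong₂ (λ s t → s + (l + t)) (sum-raise l y) (sum-raise 1 z) ⟩
      length y * l + sum y + (l + (length z * 1 + sum z))
        ≡⟨ solveℕ 5 (λ m l a s t → m :* l :+ s :+ (l :+ (a :* con 1 :+ t)) := a :+ l :+ l :* m :+ (s :+ t))
                   refl (length y) l (length z) (sum y) (sum z) ⟩
      length z + l + l * length y + (sum y + sum z)
        ≡⟨ cong (λ a → a + l + l * length y + (sum y + sum z)) lenZ ⟩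
      k ∸ l + l + l * length y + (sum y + sum z)
        ≡⟨ cong (λ K → K + l * length y + (sum y + sum z)) (m∸n+n≡m l≤k) ⟩
      k + l * length y + (sum y + sum z) ∎
      where open ≡-Reasoning
    injective : ∀ {p p′} → HookPieces l p → HookPieces l p′ → glued l p ≡ glued l p′ → p ≡ p′
    injective ((lenY , _) , _) ((lenY′ , _) , _) eq with glue-injective (trans lenY (sym lenY′)) eq
    ... | _ , y≡y′ , z≡z′ = cong₂ _,_ y≡y′ z≡z′
    series : qPow (k + l * m) ⊗ (qPochInv (+ m) ⊗ boxSeries (k ∸ l) (l ∸ 1)) ≋ rhsTerm h k l
    series = begin
      qPow (k + l * m) ⊗ (qPochInv (+ m) ⊗ boxSeries (k ∸ l) (l ∸ 1))
        ≈⟨ ⊗-assoc (qPow (k + l * m)) (qPochInv (+ m)) (boxSeries (k ∸ l) (l ∸ 1)) ⟨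
      (qPow (k + l * m) ⊗ qPochInv (+ m)) ⊗ boxSeries (k ∸ l) (l ∸ 1)
        ≈⟨ ⊗-congʳ (qPow (k + l * m) ⊗ qPochInv (+ m)) (gaussBinom≋boxSeries (k ∸ l) (l ∸ 1)) ⟨
      (qPow (k + l * m) ⊗ qPochInv (+ m)) ⊗ gaussBinom (k ∸ l + (l ∸ 1)) (l ∸ 1)
        ≡⟨ cong (λ a → (qPow (k + l * m) ⊗ qPochInv (+ m)) ⊗ gaussBinom a (l ∸ 1)) (m∸n+[n∸1]≡m∸1 1≤l l≤k) ⟩
      (qPow (k + l * m) ⊗ qPochInv (+ m)) ⊗ gaussBinom (k ∸ 1) (l ∸ 1)
        ≡⟨ rhsTerm-nonneg {h} l k-h-1≡m ⟨
      rhsTerm h k l ∎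
      where open import Relation.Binary.Reasoning.Setoid (CommutativeMonoid.setoid ⊗-commutativeMonoid)

  fixedHook-enum : Enumeration (FixedHookPartition h k) sum (rhsSeries h k)
  fixedHook-enum = enum-resp-⇔ (λ (_ , (1≤l , l≤k) , g) → glued⇒fixedHook 1≤l l≤k g) fixedHook⇒glued
    (⋃-enum k glued-enum glued-index)

ΣS-zeroS : ∀ j {F} → (∀ l → F l ≡ zeroS) → ΣS j F ≋ zeroS
ΣS-zeroS zero    F≡0 = ≋-refl
ΣS-zeroS (suc j) F≡0 = coeffwise λ n → cong₂ ℤ._+_ (coeff (ΣS-zeroS j F≡0) n) (cong (λ f → f n) (F≡0 (suc j)))

fixedHook-enum : ∀ h k → Enumeration (FixedHookPartition h k) sum (rhsSeries h k)
fixedHook-enum h k = by-sign (+ k ℤ.- h ℤ.- + 1) refl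
  where
  by-sign : ∀ d → + k ℤ.- h ℤ.- + 1 ≡ d → Enumeration (FixedHookPartition h k) sum (rhsSeries h k)
  by-sign (+ m)      eq = FixedHook.fixedHook-enum h k m eq
  by-sign -[1+ r ] eq = enum-resp-≋ (≋-sym (ΣS-zeroS k (λ l → rhsTerm-negative {h} l eq))) (empty-enum no-hook)
    where
    no-hook : ∀ {μ} → ¬ FixedHookPartition h k μ
    no-hook (_ , _ , _ , _ , suc-i+h≡k) with () ← trans (sym eq) (hook-index {h} suc-i+h≡k)

mainTheorem6 : (h : ℤ) (k : ℕ) → NonZero k → (n : ℕ) →
    Σ (List (List ℕ)) (λ L →
      Unique L ×
      ((μ : List ℕ) → (μ ∈ L) ⇔ (IsPartition n μ × HasFixedHookOfSize h k μ)) ×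
      + length L ≡ rhsSeries h k n)
mainTheorem6 h k _ n = ofWeight E n , unique E n , (λ μ → mk⇔ sound′ complete′) , count E n
  where
  E = fixedHook-enum h k
  sound′ : ∀ {μ} → μ ∈ ofWeight E n → IsPartition n μ × HasFixedHookOfSize h k μ
  sound′ μ∈ with (positive , Lμ , hook) , sum≡n ← sound E μ∈ = (positive , Lμ , sum≡n) , hook
  complete′ : ∀ {μ} → IsPartition n μ × HasFixedHookOfSize h k μ → μ ∈ ofWeight E n
  complete′ {μ} ((positive , Lμ , refl) , hook) = complete E (positive , Lμ , hook)
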